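{- Let $\mathcal{C}=(C,\chi,l)$ be a simplicial model. Then there exist $X\in C$ and a formula $\varphi\in\mathcal{L}^{DSL}$ with $\mathcal{C},X\models\mathbf{D}_{\mathcal{A}}\varphi$ if and only if there exists $X\in C$ with $|X|=n+1$.
   Context: Agents $\mathcal{A}$ finite with $|\mathcal{A}|=n+1$; propositional variables $P=\bigsqcup_{a\in\mathcal{A}}P_a$, $P_a$ pairwise disjoint, countable. A simplicial model is $(C,\chi,l)$ with $C\neq\emptyset$ a collection of nonempty finite subsets of a vertex set $V$, downward closed under nonempty subsets; $\chi:V\to\mathcal{A}$ such that each simplex has at most one vertex of each colour; $\chi(X)=\{\chi(v):v\in X\}$; $l:V\to 2^P$ with $l(v)\subseteq P_{\chi(v)}$, $l(X)=\bigcup_{v\in X}l(v)$. Language $\mathcal{L}^{DSL}$: $\varphi::=p_a\mid\neg\varphi\mid(\varphi\wedge\varphi)\mid\mathbf{D}_G\varphi$ ($G\subseteq\mathcal{A}$). Semantics at $X\in C$: $p_a$ iff $a\in\chi(X)$ and $p_a\in l(X)$; $\neg,\wedge$ classical; $\mathbf{D}_G\varphi$ iff $G\subseteq\chi(X)$ and $\varphi$ holds at every $Y\in C$ with $G\subseteq\chi(X\cap Y)$. -}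

module Defs where

open import Data.Nat using (ℕ; suc)
open import Data.Fin using (Fin)
open import Data.Fin.Subset using (Subset; ⊤) renaming (_∈_ to _∈ˢ_)
open import Data.List using (List; []; length)
open import Data.List.Membership.Propositional using (_∈_)
open import Data.List.Relation.Unary.Unique.Propositional using (Unique)
open import Data.Product using (Σ; ∃; ∃-syntax; _×_)
open import Data.Empty using (⊥)
open import Relation.Nullary using (¬_)
open import Relation.Binary.PropositionalEquality using (_≡_; _≢_)

Agent : ℕ → Set
Agent n = Fin (suc n)

-- Propositional variables: P = ⨆_a P_a with each P_a countably infinite,
-- P_a = { p_(a,i) | i ∈ ℕ }.  An atom is a pair (agent a, index i).

-- A finite set of vertices is represented by a duplicate-free list.
-- "Y ⊆ X" on lists: membership inclusion.
_⊆ᴸ_ : {V : Set} → List V → List V → Set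
Y ⊆ᴸ X = ∀ {v} → v ∈ Y → v ∈ X

record SimplicialModel (n : ℕ) : Set₁ where
  field
    V : Set
    C : List V → Set
    C-unique   : ∀ {X} → C X → Unique X
    C-nonempty : ∀ {X} → C X → X ≢ []
    C-inhabited : ∃[ X ] C X
    C-down : ∀ {X Y} → C X → Unique Y → Y ≢ [] → Y ⊆ᴸ X → C Y
    χ : V → Agent n
    χ-proper : ∀ {X} → C X → ∀ {u v} → u ∈ X → v ∈ X → χ u ≡ χ v → u ≡ v
    -- l v i : the atom p_(χ v, i) belongs to l(v)  (so l(v) ⊆ P_{χ(v)})
    l : V → ℕ → Set

data Form (n : ℕ) : Set where
  atom : Agent n → ℕ → Form n
  ¬'_  : Form n → Form n
  _∧'_ : Form n → Form n → Form n
  D    : Subset (suc n) → Form n → Form n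

module _ {n : ℕ} (M : SimplicialModel n) where
  open SimplicialModel M

  _⊆χ_ : Subset (suc n) → List V → Set
  G ⊆χ X = ∀ a → a ∈ˢ G → ∃[ v ] (v ∈ X × χ v ≡ a)

  _⊆χ∩_,_ : Subset (suc n) → List V → List V → Set
  G ⊆χ∩ X , Y = ∀ a → a ∈ˢ G → ∃[ v ] (v ∈ X × v ∈ Y × χ v ≡ a)

  _⊨_ : List V → Form n → Set
  X ⊨ atom a i = (∃[ v ] (v ∈ X × χ v ≡ a))
               × (∃[ v ] (v ∈ X × χ v ≡ a × l v i))
  X ⊨ (¬' φ)   = ¬ (X ⊨ φ)
  X ⊨ (φ ∧' ψ) = (X ⊨ φ) × (X ⊨ ψ)
  X ⊨ D G φ    = (G ⊆χ X) × (∀ Y → C Y → G ⊆χ∩ X , Y → Y ⊨ φ)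

module Submission where

open import Defs
open import Data.Nat using (ℕ; suc; _≤_)
open import Data.Nat.Properties using (≤-antisym; ≤-trans; ≤-reflexive; 1+n≰n)
open import Data.Fin using (Fin; zero; suc; punchOut)
open import Data.Fin.Properties using (injective⇒≤; punchOut-injective; any?; _≟_)
open import Data.Fin.Subset using (⊤)
open import Data.Fin.Subset.Properties using (∈⊤)
open import Data.List using (List; length; lookup)
open import Data.List.Relation.Unary.Any using (index)
open import Data.List.Relation.Unary.Any.Properties using (lookup-index)
open import Data.List.Relation.Unary.All as All using ()
open import Data.List.Relation.Unary.AllPairs using (_∷_)
open import Data.List.Relation.Unary.Unique.Propositional using (Unique)
open import Data.List.Membership.Propositional.Properties using (∈-lookup)
open import Data.Product using (_×_; ∃-syntax; _,_)
open import Function.Base using (_∘_)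
open import Function.Bundles using (_⇔_; mk⇔)
open import Function.Definitions using (Injective)
open import Relation.Nullary using (yes; no)
open import Relation.Nullary.Negation using (contradiction)
open import Relation.Binary.PropositionalEquality using (_≡_; refl; sym; trans; cong)
open SimplicialModel

-- A simplex X ∈ C carries the injective colouring i ↦ χ(X[i]) of Fin |X| into the n+1
-- agents, so it is coloured by all agents exactly when |X| = n+1 (pigeonhole in both
-- directions).  D_𝒜 φ at X demands 𝒜 ⊆ χ(X), and conversely, when 𝒜 ⊆ χ(X), D_𝒜 of a
-- tautology holds at X.

Unique⇒lookup-injective : ∀ {A : Set} {xs : List A} → Unique xs →
  Injective _≡_ _≡_ (lookup xs)
Unique⇒lookup-injective (_ ∷ _)  {zero}  {zero}  _ = refl
Unique⇒lookup-injective (x∉ ∷ _) {zero}  {suc j} e = contradiction e (All.lookup x∉ (∈-lookup j))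
Unique⇒lookup-injective (x∉ ∷ _) {suc i} {zero}  e = contradiction (sym e) (All.lookup x∉ (∈-lookup i))
Unique⇒lookup-injective (_ ∷ u)  {suc i} {suc j} e = cong suc (Unique⇒lookup-injective u e)

surjective⇒≥ : ∀ {m n} (f : Fin m → Fin n) → (∀ b → ∃[ a ] f a ≡ b) → n ≤ m
surjective⇒≥ {m} {n} f surj = injective⇒≤ {f = section} section-injective
  where
  section : Fin n → Fin m
  section b with a , _ ← surj b = a

  f∘section : ∀ b → f (section b) ≡ b
  f∘section b with _ , fa≡b ← surj b = fa≡b

  section-injective : Injective _≡_ _≡_ section
  section-injective {b} {c} e = trans (sym (f∘section b)) (trans (cong f e) (f∘section c))

-- A value missed by an injective f can be punched out of its codomain.
injective⇒surjective : ∀ {m n} (f : Fin m → Fin (suc n)) → Injective _≡_ _≡_ f →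
  suc n ≤ m → ∀ b → ∃[ a ] f a ≡ b
injective⇒surjective {m} {n} f f-inj sn≤m b with any? (λ a → f a ≟ b)
... | yes hit = hit
... | no miss = contradiction (≤-trans sn≤m (injective⇒≤ {f = f′} f′-injective)) 1+n≰n
  where
  b≢f : ∀ a → b ≡ f a → _
  b≢f a e = miss (a , sym e)

  f′ : Fin m → Fin n
  f′ a = punchOut (b≢f a)

  f′-injective : Injective _≡_ _≡_ f′
  f′-injective {a} {a′} e = f-inj (punchOut-injective (b≢f a) (b≢f a′) e)

module _ {n : ℕ} (M : SimplicialModel n) where

  colouring : (X : List (V M)) → Fin (length X) → Agent n
  colouring X = χ M ∘ lookup X

  colouring-injective : ∀ {X} → C M X → Injective _≡_ _≡_ (colouring X)
  colouring-injective cX e =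
    Unique⇒lookup-injective (C-unique M cX) (χ-proper M cX (∈-lookup _) (∈-lookup _) e)

  ⊤⊆χ⇒colouring-surjective : ∀ {X} → _⊆χ_ M ⊤ X → ∀ a → ∃[ i ] colouring X i ≡ a
  ⊤⊆χ⇒colouring-surjective {X} cover a with v , v∈X , χv≡a ← cover a ∈⊤ =
    index v∈X , trans (cong (χ M) (sym (lookup-index v∈X))) χv≡a

  colouring-surjective⇒⊤⊆χ : ∀ {X} → (∀ a → ∃[ i ] colouring X i ≡ a) → _⊆χ_ M ⊤ X
  colouring-surjective⇒⊤⊆χ {X} surj a _ with i , e ← surj a = lookup X i , ∈-lookup i , e

  ⊤⊆χ⇒length≡ : ∀ {X} → C M X → _⊆χ_ M ⊤ X → length X ≡ suc n
  ⊤⊆χ⇒length≡ {X} cX cover = ≤-antisym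
    (injective⇒≤ (colouring-injective cX))
    (surjective⇒≥ (colouring X) (⊤⊆χ⇒colouring-surjective cover))

  length≡⇒⊤⊆χ : ∀ {X} → C M X → length X ≡ suc n → _⊆χ_ M ⊤ X
  length≡⇒⊤⊆χ {X} cX |X|≡ = colouring-surjective⇒⊤⊆χ
    (injective⇒surjective (colouring X) (colouring-injective cX) (≤-reflexive (sym |X|≡)))

  tautology : Form n
  tautology = ¬' (atom zero 0 ∧' (¬' atom zero 0))

  ⊨-tautology : ∀ Y → _⊨_ M Y tautology
  ⊨-tautology Y (p , ¬p) = ¬p p

  ⊨-D-tautology : ∀ {G X} → _⊆χ_ M G X → _⊨_ M X (D G tautology)
  ⊨-D-tautology G⊆χX = G⊆χX , λ Y _ _ → ⊨-tautology Y

mainTheorem6 : ∀ {n : ℕ} (M : SimplicialModel n) →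
    (∃[ X ] ∃[ φ ] (C M X × _⊨_ M X (D ⊤ φ)))
      ⇔ (∃[ X ] (C M X × length X ≡ suc n))
mainTheorem6 M = mk⇔
  (λ { (X , _ , cX , ⊤⊆χX , _) → X , cX , ⊤⊆χ⇒length≡ M cX ⊤⊆χX })
  (λ { (X , cX , |X|≡) → X , tautology M , cX , ⊨-D-tautology M (length≡⇒⊤⊆χ M cX |X|≡) })
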